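{- For all integers $n \ge 1$ and $m \ge 1$, $b(n) + m \le b(n+m)$.
   Context: A reachable pair of a digraph is an ordered pair $(\alpha,\beta)$ of (not necessarily distinct) vertices with a directed path (possibly of length $0$) from $\alpha$ to $\beta$; the weight of a digraph is its number of reachable pairs. $W(n)$ is the set of weights of digraphs on $n$ vertices, and $b(n)$ is the largest integer such that every integer $k$ with $n\le k\le b(n)$ lies in $W(n)$. -}

module Defs where

open import Data.Nat using (ℕ; suc; _≤_)
open import Data.Fin using (Fin)
open import Data.Bool using (Bool; true)
open import Data.Product using (Σ; ∃; _×_; _,_)
open import Relation.Binary.PropositionalEquality using (_≡_)
open import Relation.Binary.Construct.Closure.ReflexiveTransitive using (Star)
open import Relation.Nullary using (¬_)

-- A digraph on n vertices (vertex set Fin n) given by its adjacency relation.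
-- (Loops are allowed but irrelevant: they never change reachability.)
Digraph : ℕ → Set
Digraph n = Fin n → Fin n → Bool

Edge : ∀ {n} → Digraph n → Fin n → Fin n → Set
Edge G a b = G a b ≡ true

Reachable : ∀ {n} → Digraph n → Fin n → Fin n → Set
Reachable G = Star (Edge G)

-- The weight of G equals k: there is an enumeration of the reachable pairs
-- by Fin k without repetition (i.e. the set of reachable pairs has exactly k elements).
HasWeight : ∀ {n} → Digraph n → ℕ → Set
HasWeight {n} G k =
  Σ (Fin k → Fin n × Fin n) λ f →
    (∀ i → let (a , b) = f i in Reachable G a b)
  × (∀ i j → f i ≡ f j → i ≡ j)
  × (∀ a b → Reachable G a b → ∃ λ i → f i ≡ (a , b))

InW : ℕ → ℕ → Set
InW n k = ∃ λ (G : Digraph n) → HasWeight G k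

IsB : ℕ → ℕ → Set
IsB n b = (∀ k → n ≤ k → k ≤ b → InW n k)
        × (∀ b' → (∀ k → n ≤ k → k ≤ b' → InW n k) → b' ≤ b)

-- Adding an isolated vertex to a digraph adds exactly one reachable pair (the
-- vertex to itself), so W(n) + 1 ⊆ W(n + 1) and, iterating, W(n) + m ⊆ W(n + m).
-- Hence the interval [n, b(n)] ⊆ W(n) shifts to [n + m, b(n) + m] ⊆ W(n + m), and
-- b(n + m), being the largest end of such an interval, is at least b(n) + m.
module Submission where

open import Defs
open import Data.Nat using (ℕ; _+_; _≤_; _∸_; zero; suc)
open import Data.Nat.Properties using (+-comm; m+[n∸m]≡n; m+n≤o⇒n≤o; m+n≤o⇒m≤o∸n; m+n∸n≡m; ∸-monoˡ-≤)
open import Data.Fin using (Fin; zero; suc)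
open import Data.Bool using (false)
open import Data.Empty using (⊥; ⊥-elim)
open import Data.Product using (∃; _×_; _,_; map)
open import Relation.Binary.PropositionalEquality using (_≡_; refl; cong; subst; subst₂)
open import Relation.Binary.Construct.Closure.ReflexiveTransitive using (ε; _◅_)

addIsolated : ∀ {n} → Digraph n → Digraph (suc n)
addIsolated G zero    _       = false
addIsolated G (suc a) zero    = false
addIsolated G (suc a) (suc b) = G a b

sucPair : ∀ {n} → Fin n × Fin n → Fin (suc n) × Fin (suc n)
sucPair = map suc suc

sucPair-injective : ∀ {n} {p q : Fin n × Fin n} → sucPair p ≡ sucPair q → p ≡ q
sucPair-injective {p = _ , _} {q = _ , _} refl = refl

module _ {n} (G : Digraph n) where

  reachable-addIsolated : ∀ {a b} → Reachable G a b → Reachable (addIsolated G) (suc a) (suc b)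
  reachable-addIsolated ε       = ε
  reachable-addIsolated (e ◅ r) = e ◅ reachable-addIsolated r

  reachable-addIsolated⁻ : ∀ {a b} → Reachable (addIsolated G) (suc a) (suc b) → Reachable G a b
  reachable-addIsolated⁻ ε                       = ε
  reachable-addIsolated⁻ (_◅_ {j = zero}  () _)
  reachable-addIsolated⁻ (_◅_ {j = suc _} e r)  = e ◅ reachable-addIsolated⁻ r

  isolated-reaches-only-itself : ∀ {b} → Reachable (addIsolated G) zero b → b ≡ zero
  isolated-reaches-only-itself ε        = refl
  isolated-reaches-only-itself (() ◅ _)

  isolated-unreachable : ∀ {a} → Reachable (addIsolated G) (suc a) zero → ⊥
  isolated-unreachable (_◅_ {j = zero}  () _)
  isolated-unreachable (_◅_ {j = suc _} _ r) = isolated-unreachable r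

  hasWeight-addIsolated : ∀ {k} → HasWeight G k → HasWeight (addIsolated G) (suc k)
  hasWeight-addIsolated {k} (f , reach , inj , onto) = f′ , reach′ , inj′ , onto′
    where
    f′ : Fin (suc k) → Fin (suc n) × Fin (suc n)
    f′ zero    = zero , zero
    f′ (suc i) = sucPair (f i)

    reach′ : ∀ i → let (a , b) = f′ i in Reachable (addIsolated G) a b
    reach′ zero    = ε
    reach′ (suc i) = reachable-addIsolated (reach i)

    inj′ : ∀ i j → f′ i ≡ f′ j → i ≡ j
    inj′ zero    zero    _  = refl
    inj′ zero    (suc j) ()
    inj′ (suc i) zero    ()
    inj′ (suc i) (suc j) eq = cong suc (inj i j (sucPair-injective eq))

    onto′ : ∀ a b → Reachable (addIsolated G) a b → ∃ λ i → f′ i ≡ (a , b)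
    onto′ zero    b       r with isolated-reaches-only-itself r
    ... | refl = zero , refl
    onto′ (suc a) zero    r = ⊥-elim (isolated-unreachable r)
    onto′ (suc a) (suc b) r with onto a b (reachable-addIsolated⁻ r)
    ... | i , eq = suc i , cong sucPair eq

inW-suc : ∀ {n k} → InW n k → InW (suc n) (suc k)
inW-suc (G , w) = addIsolated G , hasWeight-addIsolated G w

inW-+ : ∀ m {n k} → InW n k → InW (m + n) (m + k)
inW-+ zero    w = w
inW-+ (suc m) w = inW-suc (inW-+ m w)

inW-interval-+ : ∀ {n b} m → (∀ k → n ≤ k → k ≤ b → InW n k) →
                 ∀ k → n + m ≤ k → k ≤ b + m → InW (n + m) k
inW-interval-+ {n} {b} m interval k n+m≤k k≤b+m =
  subst₂ InW (+-comm m n) (m+[n∸m]≡n m≤k) (inW-+ m (interval (k ∸ m) n≤k∸m k∸m≤b))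
  where
  m≤k : m ≤ k
  m≤k = m+n≤o⇒n≤o n n+m≤k
  n≤k∸m : n ≤ k ∸ m
  n≤k∸m = m+n≤o⇒m≤o∸n n n+m≤k
  k∸m≤b : k ∸ m ≤ b
  k∸m≤b = subst (k ∸ m ≤_) (m+n∸n≡m b m) (∸-monoˡ-≤ m k≤b+m)

lemma3p2 : ∀ (n m : ℕ) → 1 ≤ n → 1 ≤ m → ∀ (bn bnm : ℕ) → IsB n bn → IsB (n + m) bnm → bn + m ≤ bnm
lemma3p2 n m _ _ bn bnm (interval-n , _) (_ , maximal-n+m) =
  maximal-n+m (bn + m) (inW-interval-+ m interval-n)
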